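{- Let $g(x)=\sum_{n\ge0}g_nx^n$ and $f(x)=\sum_{n\ge0}f_nx^n$ with $f_n>0$ and $g_n>0$ for all $n\ge0$. If the matrix $\mathcal{L}(g(x),f(x))$ is totally positive, then the Riordan array $\mathcal{R}(g(x),f(x))$ is strictly totally positive; if the matrix $\mathcal{L}(g(x),xf(x))$ is totally positive, then the Riordan array $\mathcal{R}(g(x),xf(x))$ is lower strictly totally positive.
   Context: For formal power series $g(x)=\sum g_nx^n$ and $h(x)=\sum h_nx^n$, the Riordan array $\mathcal{R}(g(x),h(x))$ is the infinite matrix (rows, columns indexed from $0$) whose $(n,k)$ entry is $[x^n]\,g(x)h(x)^k$, and the left product matrix $\mathcal{L}(g(x),h(x))$ is the infinite matrix whose $(i,0)$ entry is $g_i$ and whose $(i,j)$ entry for $j\ge1$ is $h_{i-j+1}$ (interpreted as $0$ when $i-j+1<0$); i.e. its columns are $(g_0,g_1,g_2,\dots)^T$, $(h_0,h_1,h_2,\dots)^T$, $(0,h_0,h_1,\dots)^T$, $(0,0,h_0,\dots)^T,\dots$. A matrix is totally positive (TP) if all its minors are nonnegative and strictly totally positive (STP) if all its minors are positive. A lower triangular matrix $A$ is lower strictly totally positive (LSTP) if it is TP and its minor with rows $i_0<\cdots<i_k$ and columns $j_0<\cdots<j_k$ is positive whenever $i_\ell\ge j_\ell$ for every $\ell$. -}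

module Defs where

open import Level using (Level; _⊔_)
open import Algebra.Bundles using (CommutativeRing)
open import Relation.Binary.Structures using (IsStrictTotalOrder)
open import Relation.Nullary using (¬_)
open import Data.Product using (Σ; _×_; _,_)
open import Data.Sum using (_⊎_)
open import Data.Bool using (if_then_else_)
open import Data.Nat as ℕ using (ℕ; zero; suc; _∸_; _≤ᵇ_)
open import Data.Fin as Fin using (Fin; zero; suc; toℕ; punchIn)

-- The real numbers are an instance; the paper's
-- statement (about real sequences) is stated here for every ordered field.
record OrderedField (c ℓ₁ ℓ₂ : Level) : Set (Level.suc (c ⊔ ℓ₁ ⊔ ℓ₂)) where
  field
    commutativeRing : CommutativeRing c ℓ₁
  open CommutativeRing commutativeRing public
  field
    _<_               : Carrier → Carrier → Set ℓ₂
    isStrictTotalOrder : IsStrictTotalOrder _≈_ _<_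
    0<1               : 0# < 1#
    +-mono-<          : ∀ {x y} z → x < y → (x + z) < (y + z)
    *-pos             : ∀ {x y} → 0# < x → 0# < y → 0# < (x * y)
    inverse           : ∀ x → ¬ (x ≈ 0#) → Σ Carrier (λ y → (x * y) ≈ 1#)

  _≤_ : Carrier → Carrier → Set (ℓ₁ ⊔ ℓ₂)
  x ≤ y = (x < y) ⊎ (x ≈ y)

module Theory {c ℓ₁ ℓ₂ : Level} (F : OrderedField c ℓ₁ ℓ₂) where
  open OrderedField F using (Carrier; _≈_; _+_; _*_; -_; 0#; 1#; _<_; _≤_)

  Series : Set c
  Series = ℕ → Carrier

  sumF : (n : ℕ) → (Fin n → Carrier) → Carrier
  sumF zero    v = 0#
  sumF (suc n) v = v zero + sumF n (λ i → v (suc i))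

  _⋆_ : Series → Series → Series
  (a ⋆ b) n = sumF (suc n) (λ i → a (toℕ i) * b (n ∸ toℕ i))

  one : Series
  one zero    = 1#
  one (suc n) = 0#

  pow : Series → ℕ → Series
  pow h zero    = one
  pow h (suc k) = h ⋆ pow h k

  xTimes : Series → Series
  xTimes h zero    = 0#
  xTimes h (suc n) = h n

  Matrix : Set c
  Matrix = ℕ → ℕ → Carrier

  Riordan : Series → Series → Matrix
  Riordan g h n k = (g ⋆ pow h k) n

  -- left product matrix L(g,h): (i,0) entry g_i, (i,j) entry h_{i-j+1} for j ≥ 1
  -- (0 if i-j+1 < 0).  With j = suc j', h_{i-j'} when j' ≤ i.
  LeftProd : Series → Series → Matrix
  LeftProd g h i zero    = g i
  LeftProd g h i (suc j) = if j ≤ᵇ i then h (i ∸ j) else 0#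

  sgn : {n : ℕ} → Fin n → Carrier
  sgn zero    = 1#
  sgn (suc j) = - sgn j

  det : (n : ℕ) → (Fin n → Fin n → Carrier) → Carrier
  det zero    M = 1#
  det (suc n) M = sumF (suc n) (λ j → sgn j * (M zero j * det n (λ r s → M (suc r) (punchIn j s))))

  Increasing : {n : ℕ} → (Fin n → ℕ) → Set
  Increasing {n} r = ∀ (a b : Fin n) → a Fin.< b → r a ℕ.< r b

  minor : Matrix → (n : ℕ) → (Fin n → ℕ) → (Fin n → ℕ) → Carrier
  minor A n r s = det n (λ a b → A (r a) (s b))

  TP : Matrix → Set (ℓ₁ ⊔ ℓ₂)
  TP A = ∀ (n : ℕ) (r s : Fin n → ℕ) → Increasing r → Increasing s → 0# ≤ minor A n r s

  STP : Matrix → Set ℓ₂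
  STP A = ∀ (n : ℕ) (r s : Fin n → ℕ) → Increasing r → Increasing s → 0# < minor A n r s

  LSTP : Matrix → Set (ℓ₁ ⊔ ℓ₂)
  LSTP A = TP A ×
    (∀ (n : ℕ) (r s : Fin n → ℕ) → Increasing r → Increasing s →
      (∀ l → s l ℕ.≤ r l) → 0# < minor A n r s)

module Submission where

-- Column 0 of R = R(g, h) is g and column k + 1 is column k convolved with h, which is exactly what
-- the Toeplitz part of L = L(g, h) computes; hence R = L · (1 ⊕ R).  By Cauchy–Binet every minor of R
-- is a sum of products of a minor of L and a minor of 1 ⊕ R, and a minor of 1 ⊕ R is either 0 or a
-- minor of R with all column indices lowered by one.  Induction on the largest column index therefore
-- transfers total positivity from L to R.  For strict positivity one term of the Cauchy–Binet sum is
-- positive: the column set S can be chosen so that the L-minor is triangular with diagonal entries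
-- g_i and f_0, and the (1 ⊕ R)-minor reduces to a minor of R of the same kind (any minor for
-- h = f, a minor on or below the diagonal for h = x f).

open import Defs
open import Data.Nat using (ℕ)
open import Data.Product using (_×_)

open import Level using (Level; _⊔_)
open import Data.Empty using (⊥-elim)
open import Data.Sum using (_⊎_; inj₁; inj₂)
open import Data.Product using (_,_; proj₁; proj₂)
open import Data.Unit.Polymorphic using (⊤; tt)
open import Data.Bool using (true; false)
open import Data.Nat as ℕ using (zero; suc; _∸_; _≤ᵇ_; pred; z≤n; s≤s)
import Data.Nat.Properties as ℕₚ
open import Data.Fin as Fin using (Fin; zero; suc; toℕ; punchIn)
import Data.Fin.Properties as Finₚ
open import Data.Vec.Functional using ([]; _∷_)
open import Function using (_∘_)
open import Relation.Binary.PropositionalEquality as ≡ using (_≡_; _≗_)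
open import Relation.Binary.Structures using (IsStrictTotalOrder)
import Relation.Binary.Reasoning.Setoid as SetoidReasoning
import Algebra.Properties.Ring as RingProperties
import Algebra.Properties.CommutativeSemigroup as CommutativeSemigroupProperties

module RiordanTotalPositivity {c ℓ₁ ℓ₂ : Level} (F : OrderedField c ℓ₁ ℓ₂) where
  open OrderedField F hiding (zero)
  open Theory F
  open SetoidReasoning setoid
  open RingProperties ring using (-‿distribˡ-*; -‿distribʳ-*; -1*x≈-x; -‿+-comm; +-inverseʳ-unique; -0#≈0#)
  open IsStrictTotalOrder isStrictTotalOrder using (<-respʳ-≈; <-respˡ-≈) renaming (trans to <-trans)
  module +-Properties = CommutativeSemigroupProperties +-commutativeSemigroup
  module *-Properties = CommutativeSemigroupProperties *-commutativeSemigroup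

  0≤-resp-≈ : ∀ {x y} → x ≈ y → 0# ≤ x → 0# ≤ y
  0≤-resp-≈ x≈y (inj₁ 0<x) = inj₁ (<-respʳ-≈ x≈y 0<x)
  0≤-resp-≈ x≈y (inj₂ 0≈x) = inj₂ (trans 0≈x x≈y)

  0≤0 : 0# ≤ 0#
  0≤0 = inj₂ refl

  +-pos-nonneg : ∀ {x y} → 0# < x → 0# ≤ y → 0# < (x + y)
  +-pos-nonneg {x} 0<x (inj₂ 0≈y) = <-respʳ-≈ (trans (sym (+-identityʳ x)) (+-congˡ 0≈y)) 0<x
  +-pos-nonneg {x} {y} 0<x (inj₁ 0<y) =
    <-trans 0<x (<-respˡ-≈ (+-identityˡ x) (<-respʳ-≈ (+-comm y x) (+-mono-< x 0<y)))

  +-nonneg-pos : ∀ {x y} → 0# ≤ x → 0# < y → 0# < (x + y)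
  +-nonneg-pos {x} {y} 0≤x 0<y = <-respʳ-≈ (+-comm y x) (+-pos-nonneg 0<y 0≤x)

  +-nonneg : ∀ {x y} → 0# ≤ x → 0# ≤ y → 0# ≤ (x + y)
  +-nonneg (inj₁ 0<x) 0≤y = inj₁ (+-pos-nonneg 0<x 0≤y)
  +-nonneg {x} {y} (inj₂ 0≈x) 0≤y = 0≤-resp-≈ (trans (sym (+-identityˡ y)) (+-congʳ 0≈x)) 0≤y

  *-nonneg : ∀ {x y} → 0# ≤ x → 0# ≤ y → 0# ≤ (x * y)
  *-nonneg (inj₁ 0<x) (inj₁ 0<y) = inj₁ (*-pos 0<x 0<y)
  *-nonneg {x} {y} (inj₂ 0≈x) _ = inj₂ (trans (sym (zeroˡ y)) (*-congʳ 0≈x))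
  *-nonneg {x} {y} (inj₁ _) (inj₂ 0≈y) = inj₂ (trans (sym (zeroʳ x)) (*-congˡ 0≈y))

  sumF-cong : ∀ n {v w : Fin n → Carrier} → (∀ i → v i ≈ w i) → sumF n v ≈ sumF n w
  sumF-cong zero    v≈w = refl
  sumF-cong (suc n) v≈w = +-cong (v≈w zero) (sumF-cong n (v≈w ∘ suc))

  sumF-≈0 : ∀ n {v : Fin n → Carrier} → (∀ i → v i ≈ 0#) → sumF n v ≈ 0#
  sumF-≈0 zero    v≈0 = refl
  sumF-≈0 (suc n) v≈0 = trans (+-cong (v≈0 zero) (sumF-≈0 n (v≈0 ∘ suc))) (+-identityˡ 0#)

  sumF-+ : ∀ n (v w : Fin n → Carrier) → sumF n (λ i → v i + w i) ≈ sumF n v + sumF n w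
  sumF-+ zero    v w = sym (+-identityˡ 0#)
  sumF-+ (suc n) v w = trans (+-congˡ (sumF-+ n (v ∘ suc) (w ∘ suc))) (+-Properties.interchange _ _ _ _)

  sumF-*ˡ : ∀ n x (v : Fin n → Carrier) → sumF n (λ i → x * v i) ≈ x * sumF n v
  sumF-*ˡ zero    x v = sym (zeroʳ x)
  sumF-*ˡ (suc n) x v = trans (+-congˡ (sumF-*ˡ n x (v ∘ suc))) (sym (distribˡ x _ _))

  sumF-*ʳ : ∀ n x (v : Fin n → Carrier) → sumF n (λ i → v i * x) ≈ sumF n v * x
  sumF-*ʳ n x v = trans (sumF-cong n (λ i → *-comm (v i) x)) (trans (sumF-*ˡ n x v) (*-comm x _))

  sumF-neg : ∀ n (v : Fin n → Carrier) → sumF n (λ i → - v i) ≈ - sumF n v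
  sumF-neg zero    v = sym -0#≈0#
  sumF-neg (suc n) v = trans (+-congˡ (sumF-neg n (v ∘ suc))) (-‿+-comm _ _)

  sumF-comm : ∀ n m (v : Fin n → Fin m → Carrier) →
    sumF n (λ i → sumF m (v i)) ≈ sumF m (λ j → sumF n (λ i → v i j))
  sumF-comm zero    m v = sym (sumF-≈0 m (λ _ → refl))
  sumF-comm (suc n) m v =
    trans (+-congˡ (sumF-comm n m (v ∘ suc))) (sym (sumF-+ m (v zero) (λ j → sumF n (λ i → v (suc i) j))))

  sumF-split : ∀ a d (φ : ℕ → Carrier) →
    sumF (a ℕ.+ d) (φ ∘ toℕ) ≈ sumF a (φ ∘ toℕ) + sumF d (λ j → φ (a ℕ.+ toℕ j))
  sumF-split zero    d φ = sym (+-identityˡ _)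
  sumF-split (suc a) d φ = trans (+-congˡ (sumF-split a d (φ ∘ suc))) (sym (+-assoc _ _ _))

  *-swap-pairs : ∀ x y u w e → x * (y * (u * (w * e))) ≈ u * (w * (x * (y * e)))
  *-swap-pairs x y u w e = begin
    x * (y * (u * (w * e)))  ≈⟨ *-congˡ (*-Properties.x∙yz≈y∙xz y u _) ⟩
    x * (u * (y * (w * e)))  ≈⟨ *-congˡ (*-congˡ (*-Properties.x∙yz≈y∙xz y w e)) ⟩
    x * (u * (w * (y * e)))  ≈⟨ *-Properties.x∙yz≈y∙xz x u _ ⟩
    u * (x * (w * (y * e)))  ≈⟨ *-congˡ (*-Properties.x∙yz≈y∙xz x w _) ⟩
    u * (w * (x * (y * e)))  ∎

  sumF-comm-scaled : ∀ n m (x y : Fin n → Carrier) (u w : Fin m → Carrier) (e : Fin n → Fin m → Carrier) →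
    sumF n (λ j → x j * (y j * sumF m (λ i → u i * (w i * e j i)))) ≈
    sumF m (λ i → u i * (w i * sumF n (λ j → x j * (y j * e j i))))
  sumF-comm-scaled n m x y u w e = begin
    sumF n (λ j → x j * (y j * sumF m (λ i → u i * (w i * e j i))))
      ≈⟨ sumF-cong n (λ j → trans (*-congˡ (sym (sumF-*ˡ m (y j) _))) (sym (sumF-*ˡ m (x j) _))) ⟩
    sumF n (λ j → sumF m (λ i → x j * (y j * (u i * (w i * e j i)))))
      ≈⟨ sumF-comm n m _ ⟩
    sumF m (λ i → sumF n (λ j → x j * (y j * (u i * (w i * e j i)))))
      ≈⟨ sumF-cong m (λ i → sumF-cong n (λ j → *-swap-pairs (x j) (y j) (u i) (w i) (e j i))) ⟩
    sumF m (λ i → sumF n (λ j → u i * (w i * (x j * (y j * e j i)))))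
      ≈⟨ sumF-cong m (λ i → trans (sumF-*ˡ n (u i) _) (*-congˡ (sumF-*ˡ n (w i) _))) ⟩
    sumF m (λ i → u i * (w i * sumF n (λ j → x j * (y j * e j i)))) ∎

  *-rearrange : ∀ s p q x y → s * ((p * q) * (x * y)) ≈ x * (p * (s * (q * y)))
  *-rearrange s p q x y = begin
    s * ((p * q) * (x * y))  ≈⟨ *-congˡ (*-assoc p q _) ⟩
    s * (p * (q * (x * y)))  ≈⟨ *-congˡ (*-congˡ (*-Properties.x∙yz≈y∙xz q x y)) ⟩
    s * (p * (x * (q * y)))  ≈⟨ *-Properties.x∙yz≈y∙xz s p _ ⟩
    p * (s * (x * (q * y)))  ≈⟨ *-congˡ (*-Properties.x∙yz≈y∙xz s x _) ⟩
    p * (x * (s * (q * y)))  ≈⟨ *-Properties.x∙yz≈y∙xz p x _ ⟩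
    x * (p * (s * (q * y)))  ∎

  sumF-negate-weights : ∀ n (x t : Fin n → Carrier) → sumF n (λ j → (- x j) * t j) ≈ - sumF n (λ j → x j * t j)
  sumF-negate-weights n x t = trans (sumF-cong n (λ j → sym (-‿distribˡ-* (x j) (t j)))) (sumF-neg n _)

  -- Determinants

  det-cong : ∀ n {M N : Fin n → Fin n → Carrier} → (∀ a b → M a b ≈ N a b) → det n M ≈ det n N
  det-cong zero    M≈N = refl
  det-cong (suc n) M≈N = sumF-cong (suc n) λ j →
    *-congˡ {sgn j} (*-cong (M≈N zero j) (det-cong n (λ r s → M≈N (suc r) (punchIn j s))))

  det-expand-column₀ : ∀ n (M : Fin (suc n) → Fin (suc n) → Carrier) →
    det (suc n) M ≈ sumF (suc n) (λ i → sgn i * (M i zero * det n (λ r s → M (punchIn i r) (suc s))))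
  det-expand-column₀ zero    M = refl
  det-expand-column₀ (suc n) M = +-congˡ (begin
    sumF (suc n) (λ j → sgn (suc j) * (M zero (suc j) * det (suc n) (λ r s → M (suc r) (punchIn (suc j) s))))
      ≈⟨ sumF-cong (suc n) (λ j → *-congˡ {sgn (suc j)} (*-congˡ {M zero (suc j)}
           (det-expand-column₀ n (λ r s → M (suc r) (punchIn (suc j) s)))))  ⟩
    sumF (suc n) (λ j → sgn (suc j) * (M zero (suc j) * sumF (suc n) (λ i → sgn i * (M (suc i) zero * minor₂ i j))))
      ≈⟨ sumF-comm-scaled (suc n) (suc n) (sgn ∘ suc) (λ j → M zero (suc j)) sgn (λ i → M (suc i) zero)
                          (λ j i → minor₂ i j) ⟩
    sumF (suc n) (λ i → sgn i * (M (suc i) zero * sumF (suc n) (λ j → (- sgn j) * (M zero (suc j) * minor₂ i j))))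
      ≈⟨ sumF-cong (suc n) (λ i → move-sign (sgn i) (M (suc i) zero) (sgn-weights-negated i)) ⟩
    sumF (suc n) (λ i → sgn (suc i) * (M (suc i) zero * sumF (suc n) (λ j → sgn j * (M zero (suc j) * minor₂ i j)))) ∎)
    where
    minor₂ : Fin (suc n) → Fin (suc n) → Carrier
    minor₂ i j = det n (λ r s → M (suc (punchIn i r)) (suc (punchIn j s)))
    sgn-weights-negated : ∀ i → sumF (suc n) (λ j → (- sgn j) * (M zero (suc j) * minor₂ i j)) ≈
                                - sumF (suc n) (λ j → sgn j * (M zero (suc j) * minor₂ i j))
    sgn-weights-negated i = sumF-negate-weights (suc n) sgn (λ j → M zero (suc j) * minor₂ i j)
    move-sign : ∀ a b {s t} → s ≈ - t → a * (b * s) ≈ (- a) * (b * t)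
    move-sign a b {s} {t} s≈-t = begin
      a * (b * s)      ≈⟨ *-congˡ (*-congˡ s≈-t) ⟩
      a * (b * (- t))  ≈⟨ *-congˡ (sym (-‿distribʳ-* b t)) ⟩
      a * (- (b * t))  ≈⟨ sym (-‿distribʳ-* a _) ⟩
      - (a * (b * t))  ≈⟨ -‿distribˡ-* a _ ⟩
      (- a) * (b * t)  ∎

  det-zero-row₀ : ∀ n (M : Fin (suc n) → Fin (suc n) → Carrier) → (∀ b → M zero b ≈ 0#) → det (suc n) M ≈ 0#
  det-zero-row₀ n M row≈0 = sumF-≈0 (suc n) λ j →
    trans (*-congˡ (trans (*-congʳ (row≈0 j)) (zeroˡ (det n (λ r s → M (suc r) (punchIn j s)))))) (zeroʳ (sgn j))

  det-zero-column₀ : ∀ n (M : Fin (suc n) → Fin (suc n) → Carrier) → (∀ a → M a zero ≈ 0#) → det (suc n) M ≈ 0#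
  det-zero-column₀ n M column≈0 = trans (det-expand-column₀ n M) (sumF-≈0 (suc n) λ i →
    trans (*-congˡ (trans (*-congʳ (column≈0 i)) (zeroˡ (det n (λ r s → M (punchIn i r) (suc s)))))) (zeroʳ (sgn i)))

  det-equal-rows₀₁ : ∀ n (M : Fin (suc (suc n)) → Fin (suc (suc n)) → Carrier) →
    (∀ b → M zero b ≈ M (suc zero) b) → det (suc (suc n)) M ≈ 0#

  det-equal-rows₀₁-others : ∀ n (M : Fin (suc (suc n)) → Fin (suc (suc n)) → Carrier) →
    (∀ b → M zero b ≈ M (suc zero) b) →
    sumF n (λ i → sgn (suc (suc i)) * (M (suc (suc i)) zero * det (suc n) (λ r s → M (punchIn (suc (suc i)) r) (suc s))))
      ≈ 0#
  det-equal-rows₀₁-others zero    M row₀≈row₁ = refl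
  det-equal-rows₀₁-others (suc n) M row₀≈row₁ = sumF-≈0 (suc n) λ i →
    trans (*-congˡ {sgn (suc (suc i))} (trans (*-congˡ
            (det-equal-rows₀₁ n (λ r s → M (punchIn (suc (suc i)) r) (suc s)) (row₀≈row₁ ∘ suc)))
            (zeroʳ (M (suc (suc i)) zero))))
          (zeroʳ _)

  det-equal-rows₀₁ n M row₀≈row₁ = begin
    det (suc (suc n)) M
      ≈⟨ det-expand-column₀ (suc n) M ⟩
    1# * (M zero zero * minor₀) + (- 1# * (M (suc zero) zero * minor₁) + _)
      ≈⟨ +-cong (*-congˡ (*-cong (row₀≈row₁ zero) minor₀≈minor₁))
                (+-cong (-1*x≈-x _) (det-equal-rows₀₁-others n M row₀≈row₁)) ⟩
    1# * (M (suc zero) zero * minor₁) + (- (M (suc zero) zero * minor₁) + 0#)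
      ≈⟨ +-cong (*-identityˡ _) (+-identityʳ _) ⟩
    M (suc zero) zero * minor₁ + - (M (suc zero) zero * minor₁)
      ≈⟨ -‿inverseʳ _ ⟩
    0# ∎
    where
    minor₀ minor₁ : Carrier
    minor₀ = det (suc n) (λ r s → M (suc r) (suc s))
    minor₁ = det (suc n) (λ r s → M (punchIn (suc zero) r) (suc s))
    minor₀≈minor₁ : minor₀ ≈ minor₁
    minor₀≈minor₁ = det-cong (suc n) {λ r s → M (suc r) (suc s)} {λ r s → M (punchIn (suc zero) r) (suc s)}
      λ { zero s → sym (row₀≈row₁ (suc s)) ; (suc r) s → refl }

  det-linear-row₀ : ∀ n (x y : Fin (suc n) → Carrier) (R : Fin n → Fin (suc n) → Carrier) →
    det (suc n) ((λ b → x b + y b) ∷ R) ≈ det (suc n) (x ∷ R) + det (suc n) (y ∷ R)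
  det-linear-row₀ n x y R = trans (sumF-cong (suc n) term)
    (sumF-+ (suc n) (λ j → sgn j * (x j * minor′ j)) (λ j → sgn j * (y j * minor′ j)))
    where
    minor′ : Fin (suc n) → Carrier
    minor′ j = det n (λ r s → R r (punchIn j s))
    term : ∀ j → sgn j * ((x j + y j) * minor′ j) ≈ sgn j * (x j * minor′ j) + sgn j * (y j * minor′ j)
    term j = trans (*-congˡ (distribʳ _ (x j) (y j))) (distribˡ (sgn j) _ _)

  det-linear-row₁ : ∀ n (x y z : Fin (suc (suc n)) → Carrier) (R : Fin n → Fin (suc (suc n)) → Carrier) →
    det (suc (suc n)) (x ∷ (λ b → y b + z b) ∷ R) ≈ det (suc (suc n)) (x ∷ y ∷ R) + det (suc (suc n)) (x ∷ z ∷ R)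
  det-linear-row₁ n x y z R = trans (sumF-cong (suc (suc n)) term)
    (sumF-+ (suc (suc n)) (λ j → sgn j * (x j * rowMinor y j)) (λ j → sgn j * (x j * rowMinor z j)))
    where
    rowMinor : (Fin (suc (suc n)) → Carrier) → Fin (suc (suc n)) → Carrier
    rowMinor w j = det (suc n) ((w ∘ punchIn j) ∷ (λ r s → R r (punchIn j s)))
    term : ∀ j → sgn j * (x j * rowMinor (λ b → y b + z b) j) ≈ sgn j * (x j * rowMinor y j) + sgn j * (x j * rowMinor z j)
    term j = trans (*-congˡ (trans (*-congˡ (det-linear-row₀ n (y ∘ punchIn j) (z ∘ punchIn j) (λ r s → R r (punchIn j s))))
                                    (distribˡ (x j) _ _)))
                   (distribˡ (sgn j) _ _)

  det-swap-rows₀₁ : ∀ n (x y : Fin (suc (suc n)) → Carrier) (R : Fin n → Fin (suc (suc n)) → Carrier) →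
    det (suc (suc n)) (y ∷ x ∷ R) ≈ - det (suc (suc n)) (x ∷ y ∷ R)
  det-swap-rows₀₁ n x y R = +-inverseʳ-unique _ _ (begin
    d x y + d y x                     ≈⟨ sym (+-cong (+-identityˡ _) (+-identityʳ _)) ⟩
    (0# + d x y) + (d y x + 0#)       ≈⟨ sym (+-cong (+-congʳ (equal x)) (+-congˡ (equal y))) ⟩
    (d x x + d x y) + (d y x + d y y) ≈⟨ sym (+-cong (det-linear-row₁ n x x y R) (det-linear-row₁ n y x y R)) ⟩
    d x x+y + d y x+y                 ≈⟨ sym (det-linear-row₀ (suc n) x y (x+y ∷ R)) ⟩
    d x+y x+y                         ≈⟨ equal x+y ⟩
    0# ∎)
    where
    d : (u v : Fin (suc (suc n)) → Carrier) → Carrier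
    d u v = det (suc (suc n)) (u ∷ v ∷ R)
    x+y : Fin (suc (suc n)) → Carrier
    x+y b = x b + y b
    equal : ∀ u → d u u ≈ 0#
    equal u = det-equal-rows₀₁ n (u ∷ u ∷ R) (λ _ → refl)

  det-lowerTriangular-pos : ∀ n (M : Fin n → Fin n → Carrier) →
    (∀ a b → a Fin.< b → M a b ≈ 0#) → (∀ a → 0# < M a a) → 0# < det n M
  det-lowerTriangular-pos zero    M upper≈0 0<diag = 0<1
  det-lowerTriangular-pos (suc n) M upper≈0 0<diag = +-pos-nonneg
    (*-pos 0<1 (*-pos (0<diag zero) (det-lowerTriangular-pos n (λ r s → M (suc r) (suc s))
       (λ a b a<b → upper≈0 (suc a) (suc b) (s≤s a<b)) (0<diag ∘ suc))))
    (inj₂ (sym (sumF-≈0 n λ j →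
      trans (*-congˡ (trans (*-congʳ (upper≈0 zero (suc j) (s≤s z≤n)))
                            (zeroˡ (det n (λ r s → M (suc r) (punchIn (suc j) s))))))
            (zeroʳ (sgn (suc j))))))

  RowFunction : ℕ → Set c
  RowFunction n = (Fin n → ℕ) → Carrier

  Extensional : ∀ {n} → RowFunction n → Set ℓ₁
  Extensional D = ∀ {R R′} → R ≗ R′ → D R ≈ D R′

  Alternating : ∀ n → RowFunction n → Set ℓ₁
  Alternating zero          D = ⊤
  Alternating (suc zero)    D = ⊤
  Alternating (suc (suc n)) D =
    (∀ x R → D (x ∷ x ∷ R) ≈ 0#) × (∀ x y R → D (x ∷ y ∷ R) ≈ - D (y ∷ x ∷ R)) ×
    (∀ x → Alternating (suc n) (λ R → D (x ∷ R)))

  shift : ∀ {k} → (Fin k → ℕ) → Fin k → ℕ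
  shift R = suc ∘ R

  ∷-≗ : ∀ {k} x {R R′ : Fin k → ℕ} → R ≗ R′ → (x ∷ R) ≗ (x ∷ R′)
  ∷-≗ x R≗R′ zero    = ≡.refl
  ∷-≗ x R≗R′ (suc i) = R≗R′ i

  shift-∷ : ∀ {k} x (R : Fin k → ℕ) → shift (x ∷ R) ≗ suc x ∷ shift R
  shift-∷ x R zero    = ≡.refl
  shift-∷ x R (suc i) = ≡.refl

  shift-∷₂ : ∀ {k} x y (R : Fin k → ℕ) → shift (x ∷ y ∷ R) ≗ suc x ∷ suc y ∷ shift R
  shift-∷₂ x y R zero          = ≡.refl
  shift-∷₂ x y R (suc zero)    = ≡.refl
  shift-∷₂ x y R (suc (suc i)) = ≡.refl

  Extensional-shift : ∀ {n} {D : RowFunction n} → Extensional D → Extensional (D ∘ shift)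
  Extensional-shift ext R≗R′ = ext (≡.cong suc ∘ R≗R′)

  Extensional-∷ : ∀ {n} x {D : RowFunction (suc n)} → Extensional D → Extensional (λ R → D (x ∷ R))
  Extensional-∷ x ext R≗R′ = ext (∷-≗ x R≗R′)

  Alternating-resp : ∀ n {D D′ : RowFunction n} → (∀ R → D R ≈ D′ R) → Alternating n D → Alternating n D′
  Alternating-resp zero          D≈D′ _ = tt
  Alternating-resp (suc zero)    D≈D′ _ = tt
  Alternating-resp (suc (suc n)) D≈D′ (equal , swap , tail) =
    (λ x R → trans (sym (D≈D′ _)) (equal x R)) ,
    (λ x y R → trans (sym (D≈D′ _)) (trans (swap x y R) (-‿cong (D≈D′ _)))) ,
    (λ x → Alternating-resp (suc n) (D≈D′ ∘ (x ∷_)) (tail x))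

  Alternating-combination : ∀ n m (w : Fin m → Carrier) (Ds : Fin m → RowFunction n) →
    (∀ j → Alternating n (Ds j)) → Alternating n (λ R → sumF m (λ j → w j * Ds j R))
  Alternating-combination zero          m w Ds _   = tt
  Alternating-combination (suc zero)    m w Ds _   = tt
  Alternating-combination (suc (suc n)) m w Ds alt =
    (λ x R → sumF-≈0 m λ j → trans (*-congˡ (proj₁ (alt j) x R)) (zeroʳ (w j))) ,
    (λ x y R → trans (sumF-cong m λ j → trans (*-congˡ (proj₁ (proj₂ (alt j)) x y R))
                                              (sym (-‿distribʳ-* (w j) (Ds j (y ∷ x ∷ R)))))
                     (sumF-neg m (λ j → w j * Ds j (y ∷ x ∷ R)))) ,
    (λ x → Alternating-combination (suc n) m w (λ j R → Ds j (x ∷ R)) (λ j → proj₂ (proj₂ (alt j)) x))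

  Alternating-neg : ∀ n {D : RowFunction n} → Alternating n D → Alternating n (λ R → - D R)
  Alternating-neg n {D} alt = Alternating-resp n (λ R → trans (+-identityʳ _) (-1*x≈-x (D R)))
    (Alternating-combination n 1 (λ _ → - 1#) (λ _ → D) (λ _ → alt))

  Alternating-shift : ∀ n {D : RowFunction n} → Extensional D → Alternating n D → Alternating n (D ∘ shift)
  Alternating-shift zero          ext _ = tt
  Alternating-shift (suc zero)    ext _ = tt
  Alternating-shift (suc (suc n)) ext (equal , swap , tail) =
    (λ x R → trans (ext (shift-∷₂ x x R)) (equal (suc x) (shift R))) ,
    (λ x y R → trans (ext (shift-∷₂ x y R))
                 (trans (swap (suc x) (suc y) (shift R)) (-‿cong (ext (≡.sym ∘ shift-∷₂ y x R))))) ,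
    (λ x → Alternating-resp (suc n) (λ R → ext (≡.sym ∘ shift-∷ x R))
             (Alternating-shift (suc n) (Extensional-∷ (suc x) ext) (tail (suc x))))

  rowDet : ∀ n → (ℕ → Fin n → Carrier) → RowFunction n
  rowDet n B R = det n (λ a → B (R a))

  rowDet-extensional : ∀ n (B : ℕ → Fin n → Carrier) → Extensional (rowDet n B)
  rowDet-extensional n B R≗R′ = det-cong n (λ a b → reflexive (≡.cong (λ i → B i b) (R≗R′ a)))

  rowDet-alternating : ∀ n (B : ℕ → Fin n → Carrier) → Alternating n (rowDet n B)
  rowDet-alternating zero          B = tt
  rowDet-alternating (suc zero)    B = tt
  rowDet-alternating (suc (suc n)) B =
    (λ x R → det-equal-rows₀₁ n (λ a → B ((x ∷ x ∷ R) a)) (λ _ → refl)) ,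
    (λ x y R → det-swap-rows₀₁ n (B y) (B x) (B ∘ R)) ,
    (λ x → Alternating-resp (suc n) (λ R → sumF-cong (suc (suc n)) λ j → *-assoc (sgn j) (B x j) (minorDet j R))
             (Alternating-combination (suc n) (suc (suc n)) (λ j → sgn j * B x j) minorDet
               (λ j → rowDet-alternating (suc n) (λ i b → B i (punchIn j b)))))
    where
    minorDet : Fin (suc (suc n)) → RowFunction (suc n)
    minorDet j = rowDet (suc n) (λ i b → B i (punchIn j b))

  -- The sum of G over the increasing sequences of length k with entries below m
  -- (the k-subsets of {0, …, m - 1}), split by whether the sequence starts with 0.
  sumSubsets : (m k : ℕ) → RowFunction k → Carrier
  sumSubsets m       zero    G = G []
  sumSubsets zero    (suc k) G = 0#
  sumSubsets (suc m) (suc k) G = sumSubsets m k (λ T → G (0 ∷ shift T)) + sumSubsets m (suc k) (G ∘ shift)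

  sumSubsets-cong : ∀ m k {G H : RowFunction k} → (∀ T → G T ≈ H T) → sumSubsets m k G ≈ sumSubsets m k H
  sumSubsets-cong m       zero    G≈H = G≈H []
  sumSubsets-cong zero    (suc k) G≈H = refl
  sumSubsets-cong (suc m) (suc k) G≈H =
    +-cong (sumSubsets-cong m k (G≈H ∘ (λ T → 0 ∷ shift T))) (sumSubsets-cong m (suc k) (G≈H ∘ shift))

  sumSubsets-0 : ∀ m k → sumSubsets m k (λ _ → 0#) ≈ 0#
  sumSubsets-0 m       zero    = refl
  sumSubsets-0 zero    (suc k) = refl
  sumSubsets-0 (suc m) (suc k) = trans (+-cong (sumSubsets-0 m k) (sumSubsets-0 m (suc k))) (+-identityʳ 0#)

  sumSubsets-+ : ∀ m k (G H : RowFunction k) → sumSubsets m k (λ T → G T + H T) ≈ sumSubsets m k G + sumSubsets m k H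
  sumSubsets-+ m       zero    G H = refl
  sumSubsets-+ zero    (suc k) G H = sym (+-identityʳ 0#)
  sumSubsets-+ (suc m) (suc k) G H =
    trans (+-cong (sumSubsets-+ m k _ _) (sumSubsets-+ m (suc k) _ _)) (+-Properties.interchange _ _ _ _)

  sumSubsets-*ˡ : ∀ m k x (G : RowFunction k) → sumSubsets m k (λ T → x * G T) ≈ x * sumSubsets m k G
  sumSubsets-*ˡ m       zero    x G = refl
  sumSubsets-*ˡ zero    (suc k) x G = sym (zeroʳ x)
  sumSubsets-*ˡ (suc m) (suc k) x G =
    trans (+-cong (sumSubsets-*ˡ m k x _) (sumSubsets-*ˡ m (suc k) x _)) (sym (distribˡ x _ _))

  sumSubsets-sumF : ∀ m k n (H : Fin n → RowFunction k) →
    sumSubsets m k (λ T → sumF n (λ b → H b T)) ≈ sumF n (λ b → sumSubsets m k (H b))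
  sumSubsets-sumF m k zero    H = sumSubsets-0 m k
  sumSubsets-sumF m k (suc n) H = trans (sumSubsets-+ m k (H zero) (λ T → sumF n (λ b → H (suc b) T)))
    (+-congˡ (sumSubsets-sumF m k n (H ∘ suc)))

  -- expandRow₀ X a S is the first-row Laplace expansion of the minor with columns S of the matrix whose
  -- first row is a and whose remaining rows have minors X.
  expandRow₀ : ∀ {k} → RowFunction k → (ℕ → Carrier) → RowFunction (suc k)
  expandRow₀ {k} X a S = sumF (suc k) (λ p → sgn p * (a (S p) * X (S ∘ punchIn p)))

  punchIn-0∷shift : ∀ {k} (S : Fin (suc k) → ℕ) q → (0 ∷ shift S) ∘ punchIn (suc q) ≗ 0 ∷ shift (S ∘ punchIn q)
  punchIn-0∷shift S q zero    = ≡.refl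
  punchIn-0∷shift S q (suc b) = ≡.refl

  expandRow₀-0∷ : ∀ {k} (X : RowFunction (suc k)) a S → Extensional X →
    expandRow₀ X a (0 ∷ shift S) ≈ a 0 * X (shift S) + - expandRow₀ (λ T → X (0 ∷ shift T)) (a ∘ suc) S
  expandRow₀-0∷ {k} X a S ext = +-cong (*-identityˡ _) (begin
    sumF (suc k) (λ q → (- sgn q) * t q)   ≈⟨ sumF-negate-weights (suc k) sgn t ⟩
    - sumF (suc k) (λ q → sgn q * t q)
      ≈⟨ -‿cong (sumF-cong (suc k) λ q → *-congˡ {sgn q} (*-congˡ {a (suc (S q))} (ext (punchIn-0∷shift S q)))) ⟩
    - expandRow₀ (λ T → X (0 ∷ shift T)) (a ∘ suc) S ∎)
    where
    t : Fin (suc k) → Carrier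
    t q = a (suc (S q)) * X ((0 ∷ shift S) ∘ punchIn (suc q))

  sumSubsets-insert₀ : ∀ m (X : RowFunction 0) (a : ℕ → Carrier) (D : RowFunction 1) → Extensional X → Extensional D →
    X [] * sumF m (λ j → a (toℕ j) * D (toℕ j ∷ [])) ≈ sumSubsets m 1 (λ S → expandRow₀ X a S * D S)
  sumSubsets-insert₀ zero    X a D extX extD = zeroʳ (X [])
  sumSubsets-insert₀ (suc m) X a D extX extD = begin
    X [] * (a 0 * D (0 ∷ []) + sumF m (λ j → a (suc (toℕ j)) * D (suc (toℕ j) ∷ [])))
      ≈⟨ distribˡ (X []) _ _ ⟩
    X [] * (a 0 * D (0 ∷ [])) + X [] * sumF m (λ j → a (suc (toℕ j)) * D (suc (toℕ j) ∷ []))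
      ≈⟨ +-cong singleton-0 (trans (*-cong (extX (λ ())) (sumF-cong m λ j → *-congˡ (extD (λ { zero → ≡.refl }))))
                                   (sumSubsets-insert₀ m (X ∘ shift) (a ∘ suc) (D ∘ shift)
                                      (Extensional-shift extX) (Extensional-shift extD))) ⟩
    expandRow₀ X a (0 ∷ shift []) * D (0 ∷ shift []) + sumSubsets m 1 (λ S → expandRow₀ X a (shift S) * D (shift S)) ∎
    where
    singleton-0 : X [] * (a 0 * D (0 ∷ [])) ≈ expandRow₀ X a (0 ∷ shift []) * D (0 ∷ shift [])
    singleton-0 = begin
      X [] * (a 0 * D (0 ∷ []))                    ≈⟨ *-congˡ (*-congˡ (extD (λ { zero → ≡.refl }))) ⟩
      X [] * (a 0 * D (0 ∷ shift []))              ≈⟨ *-Properties.x∙yz≈yx∙z (X []) (a 0) _ ⟩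
      (a 0 * X []) * D (0 ∷ shift [])              ≈⟨ *-congʳ (sym (trans (+-identityʳ _) (*-identityˡ _))) ⟩
      (1# * (a 0 * X []) + 0#) * D (0 ∷ shift [])  ≈⟨ *-congʳ (+-congʳ (*-congˡ (*-congˡ (extX (λ ()))))) ⟩
      expandRow₀ X a (0 ∷ shift []) * D (0 ∷ shift []) ∎

  -- Summing the Laplace expansions of all (k+1)-minors against an alternating D is the same as
  -- inserting one more index j in front of every k-subset T.
  sumSubsets-insert : ∀ m k (X : RowFunction k) (a : ℕ → Carrier) (D : RowFunction (suc k)) →
    Extensional X → Extensional D → Alternating (suc k) D →
    sumSubsets m k (λ T → X T * sumF m (λ j → a (toℕ j) * D (toℕ j ∷ T))) ≈
    sumSubsets m (suc k) (λ S → expandRow₀ X a S * D S)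
  sumSubsets-insert m       zero    X a D extX extD alt = sumSubsets-insert₀ m X a D extX extD
  sumSubsets-insert zero    (suc k) X a D extX extD alt = refl
  sumSubsets-insert (suc m) (suc k) X a D extX extD alt@(equal , swap , tail) = begin
    sumSubsets m k (λ T → X (0 ∷ shift T) * (a 0 * D (0 ∷ 0 ∷ shift T) + inner (0 ∷ shift T))) +
    sumSubsets m (suc k) (λ T → X (shift T) * (a 0 * D (0 ∷ shift T) + inner (shift T)))
      ≈⟨ +-cong (sumSubsets-cong m k λ T → *-congˡ (trans (+-congʳ (trans (*-congˡ (equal 0 (shift T))) (zeroʳ (a 0))))
                                                          (+-identityˡ _)))
                (trans (sumSubsets-cong m (suc k) (λ T → distribˡ (X (shift T)) _ _)) (sumSubsets-+ m (suc k) _ _)) ⟩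
    P₀ + (Q₀ + Q₊)
      ≈⟨ +-Properties.x∙yz≈yx∙z P₀ Q₀ Q₊ ⟩
    (Q₀ + P₀) + Q₊
      ≈⟨ +-cong (sym starting-with-0)
                (trans (sumSubsets-cong m (suc k) λ T → *-congˡ (sumF-cong m λ j →
                          *-congˡ (extD (≡.sym ∘ shift-∷ (toℕ j) T))))
                       (sumSubsets-insert m (suc k) (X ∘ shift) (a ∘ suc) (D ∘ shift)
                          (Extensional-shift extX) (Extensional-shift extD) (Alternating-shift (suc (suc k)) extD alt))) ⟩
    sumSubsets m (suc k) (λ S → expandRow₀ X a (0 ∷ shift S) * D (0 ∷ shift S)) +
    sumSubsets m (suc (suc k)) (λ S → expandRow₀ X a (shift S) * D (shift S)) ∎
    where
    inner : RowFunction (suc k)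
    inner T = sumF m (λ j → a (suc (toℕ j)) * D (suc (toℕ j) ∷ T))
    P₀ Q₀ Q₊ : Carrier
    P₀ = sumSubsets m k (λ T → X (0 ∷ shift T) * inner (0 ∷ shift T))
    Q₀ = sumSubsets m (suc k) (λ T → X (shift T) * (a 0 * D (0 ∷ shift T)))
    Q₊ = sumSubsets m (suc k) (λ T → X (shift T) * inner (shift T))
    X₀ : RowFunction k
    X₀ T = X (0 ∷ shift T)
    D₀ : RowFunction (suc k)
    D₀ R = - D (0 ∷ shift R)
    starting-with-0 : sumSubsets m (suc k) (λ S → expandRow₀ X a (0 ∷ shift S) * D (0 ∷ shift S)) ≈ Q₀ + P₀
    starting-with-0 = begin
      sumSubsets m (suc k) (λ S → expandRow₀ X a (0 ∷ shift S) * D (0 ∷ shift S))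
        ≈⟨ sumSubsets-cong m (suc k) (λ S → *-congʳ (expandRow₀-0∷ X a S extX)) ⟩
      sumSubsets m (suc k) (λ S → (a 0 * X (shift S) + - expandRow₀ X₀ (a ∘ suc) S) * D (0 ∷ shift S))
        ≈⟨ trans (sumSubsets-cong m (suc k) λ S → trans (distribʳ _ _ _)
                    (+-cong (sym (*-Properties.x∙yz≈yx∙z (X (shift S)) (a 0) _))
                            (trans (sym (-‿distribˡ-* _ _)) (-‿distribʳ-* _ _))))
                 (sumSubsets-+ m (suc k) _ _) ⟩
      Q₀ + sumSubsets m (suc k) (λ S → expandRow₀ X₀ (a ∘ suc) S * D₀ S)
        ≈⟨ +-congˡ (sym (trans P₀≈ (sumSubsets-insert m k X₀ (a ∘ suc) D₀
             (Extensional-shift (Extensional-∷ 0 extX)) (-‿cong ∘ Extensional-shift (Extensional-∷ 0 extD))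
             (Alternating-neg (suc k) (Alternating-shift (suc k) (Extensional-∷ 0 extD) (tail 0)))))) ⟩
      Q₀ + P₀ ∎
      where
      -- inserting j in front of 0 ∷ T instead of after 0 costs the sign carried by D₀
      P₀≈ : P₀ ≈ sumSubsets m k (λ T → X₀ T * sumF m (λ j → a (suc (toℕ j)) * D₀ (toℕ j ∷ T)))
      P₀≈ = sumSubsets-cong m k λ T → *-congˡ (sumF-cong m λ j → *-congˡ
        (trans (swap (suc (toℕ j)) 0 (shift T)) (-‿cong (extD (∷-≗ 0 (≡.sym ∘ shift-∷ (toℕ j) T))))))

  -- Cauchy–Binet

  sumF-sumSubsets-exchange : ∀ m k n (σ : Fin n → Carrier) (p : Fin m → Carrier) (q : Fin m → Fin n → Carrier)
    (X : RowFunction k) (Y : Fin n → RowFunction k) →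
    sumF n (λ b → σ b * (sumF m (λ j → p j * q j b) * sumSubsets m k (λ T → X T * Y b T))) ≈
    sumSubsets m k (λ T → X T * sumF m (λ j → p j * sumF n (λ b → σ b * (q j b * Y b T))))
  sumF-sumSubsets-exchange m k n σ p q X Y = begin
    sumF n (λ b → σ b * (sumF m (λ j → p j * q j b) * sumSubsets m k (λ T → X T * Y b T)))
      ≈⟨ sumF-cong n (λ b → *-congˡ (trans (sym (sumSubsets-*ˡ m k _ _)) (sumSubsets-cong m k λ T →
           sym (sumF-*ʳ m (X T * Y b T) (λ j → p j * q j b))))) ⟩
    sumF n (λ b → σ b * sumSubsets m k (λ T → sumF m (λ j → (p j * q j b) * (X T * Y b T))))
      ≈⟨ sumF-cong n (λ b → trans (sym (sumSubsets-*ˡ m k (σ b) _))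
                                  (sumSubsets-cong m k λ T → sym (sumF-*ˡ m (σ b) _))) ⟩
    sumF n (λ b → sumSubsets m k (λ T → sumF m (λ j → σ b * ((p j * q j b) * (X T * Y b T)))))
      ≈⟨ sym (sumSubsets-sumF m k n _) ⟩
    sumSubsets m k (λ T → sumF n (λ b → sumF m (λ j → σ b * ((p j * q j b) * (X T * Y b T)))))
      ≈⟨ sumSubsets-cong m k (λ T → sumF-comm n m _) ⟩
    sumSubsets m k (λ T → sumF m (λ j → sumF n (λ b → σ b * ((p j * q j b) * (X T * Y b T)))))
      ≈⟨ sumSubsets-cong m k (λ T → sumF-cong m λ j → sumF-cong n λ b → *-rearrange (σ b) (p j) (q j b) (X T) (Y b T)) ⟩
    sumSubsets m k (λ T → sumF m (λ j → sumF n (λ b → X T * (p j * (σ b * (q j b * Y b T))))))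
      ≈⟨ sumSubsets-cong m k (λ T → trans (sumF-cong m λ j → trans (sumF-*ˡ n (X T) _) (*-congˡ (sumF-*ˡ n (p j) _)))
                                          (sumF-*ˡ m (X T) _)) ⟩
    sumSubsets m k (λ T → X T * sumF m (λ j → p j * sumF n (λ b → σ b * (q j b * Y b T)))) ∎

  cauchy-binet : ∀ k m (A : Fin k → ℕ → Carrier) (B : ℕ → Fin k → Carrier) →
    det k (λ a b → sumF m (λ j → A a (toℕ j) * B (toℕ j) b)) ≈
    sumSubsets m k (λ S → det k (λ a b → A a (S b)) * det k (λ a b → B (S a) b))
  cauchy-binet zero    m A B = sym (*-identityˡ 1#)
  cauchy-binet (suc k) m A B = begin
    sumF (suc k) (λ b → sgn b * (sumF m (λ j → A zero (toℕ j) * B (toℕ j) b) *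
      det k (λ r s → sumF m (λ j → A (suc r) (toℕ j) * B (toℕ j) (punchIn b s)))))
      ≈⟨ sumF-cong (suc k) (λ b → *-congˡ {sgn b} (*-congˡ {sumF m (λ j → A zero (toℕ j) * B (toℕ j) b)}
           (cauchy-binet k m (A ∘ suc) (λ j s → B j (punchIn b s))))) ⟩
    sumF (suc k) (λ b → sgn b * (sumF m (λ j → A zero (toℕ j) * B (toℕ j) b) * sumSubsets m k (λ T → X T * Y b T)))
      ≈⟨ sumF-sumSubsets-exchange m k (suc k) sgn (A zero ∘ toℕ) (B ∘ toℕ) X Y ⟩
    sumSubsets m k (λ T → X T * sumF m (λ j → A zero (toℕ j) * rowDet (suc k) B (toℕ j ∷ T)))
      ≈⟨ sumSubsets-insert m k X (A zero) (rowDet (suc k) B)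
           (λ T≗T′ → det-cong k (λ r s → reflexive (≡.cong (A (suc r)) (T≗T′ s))))
           (rowDet-extensional (suc k) B) (rowDet-alternating (suc k) B) ⟩
    sumSubsets m (suc k) (λ S → det (suc k) (λ a b → A a (S b)) * det (suc k) (λ a b → B (S a) b)) ∎
    where
    X : RowFunction k
    X T = det k (λ r s → A (suc r) (T s))
    Y : Fin (suc k) → RowFunction k
    Y b T = det k (λ r s → B (T r) (punchIn b s))

  _≋_ : Series → Series → Set ℓ₁
  a ≋ b = ∀ n → a n ≈ b n

  ⋆-congˡ : ∀ a {b b′} → b ≋ b′ → (a ⋆ b) ≋ (a ⋆ b′)
  ⋆-congˡ a b≋b′ n = sumF-cong (suc n) (λ i → *-congˡ {a (toℕ i)} (b≋b′ (n ∸ toℕ i)))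

  ⋆-distribʳ-+ : ∀ (x y z : Series) → ((λ i → x i + y i) ⋆ z) ≋ (λ n → (x ⋆ z) n + (y ⋆ z) n)
  ⋆-distribʳ-+ x y z n = trans (sumF-cong (suc n) (λ i → distribʳ (z (n ∸ toℕ i)) (x (toℕ i)) (y (toℕ i))))
                               (sumF-+ (suc n) (λ i → x (toℕ i) * z (n ∸ toℕ i)) (λ i → y (toℕ i) * z (n ∸ toℕ i)))

  ⋆-*ˡ : ∀ s (x z : Series) → ((λ i → s * x i) ⋆ z) ≋ (λ n → s * (x ⋆ z) n)
  ⋆-*ˡ s x z n = trans (sumF-cong (suc n) (λ i → *-assoc s (x (toℕ i)) (z (n ∸ toℕ i))))
                       (sumF-*ˡ (suc n) s (λ i → x (toℕ i) * z (n ∸ toℕ i)))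

  -- (a ⋆ b) (1 + n) unfolds to a₀ b₁₊ₙ + ((a ∘ suc) ⋆ b) n, which drives the induction.
  ⋆-assoc : ∀ (a b z : Series) → ((a ⋆ b) ⋆ z) ≋ (a ⋆ (b ⋆ z))
  ⋆-assoc a b z zero = +-congʳ (trans (*-congʳ (+-identityʳ _))
    (trans (*-assoc (a 0) (b 0) (z 0)) (*-congˡ (sym (+-identityʳ _)))))
  ⋆-assoc a b z (suc n) = begin
    (a 0 * b 0 + 0#) * z (suc n) + ((λ i → (a ⋆ b) (suc i)) ⋆ z) n
      ≈⟨ +-cong (trans (*-congʳ (+-identityʳ _)) (*-assoc (a 0) (b 0) (z (suc n))))
                (trans (⋆-distribʳ-+ (λ i → a 0 * b (suc i)) ((a ∘ suc) ⋆ b) z n)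
                       (+-cong (⋆-*ˡ (a 0) (b ∘ suc) z n) (⋆-assoc (a ∘ suc) b z n))) ⟩
    a 0 * (b 0 * z (suc n)) + (a 0 * ((b ∘ suc) ⋆ z) n + ((a ∘ suc) ⋆ (b ⋆ z)) n)
      ≈⟨ sym (+-assoc _ _ _) ⟩
    (a 0 * (b 0 * z (suc n)) + a 0 * ((b ∘ suc) ⋆ z) n) + ((a ∘ suc) ⋆ (b ⋆ z)) n
      ≈⟨ +-congʳ (sym (distribˡ (a 0) _ _)) ⟩
    a 0 * (b 0 * z (suc n) + ((b ∘ suc) ⋆ z) n) + ((a ∘ suc) ⋆ (b ⋆ z)) n ∎

  ⋆-identityˡ : ∀ h → (one ⋆ h) ≋ h
  ⋆-identityˡ h n = trans (+-cong (*-identityˡ (h n)) (sumF-≈0 n (λ i → zeroˡ (h (n ∸ suc (toℕ i)))))) (+-identityʳ _)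

  ⋆-identityʳ : ∀ h → (h ⋆ one) ≋ h
  ⋆-identityʳ h zero    = trans (+-identityʳ _) (*-identityʳ (h 0))
  ⋆-identityʳ h (suc n) = trans (+-cong (zeroʳ (h 0)) (⋆-identityʳ (h ∘ suc) n)) (+-identityˡ _)

  pow-comm : ∀ h k → (pow h k ⋆ h) ≋ (h ⋆ pow h k)
  pow-comm h zero    n = trans (⋆-identityˡ h n) (sym (⋆-identityʳ h n))
  pow-comm h (suc k) n = trans (⋆-assoc h (pow h k) h n) (⋆-congˡ h (pow-comm h k) n)

  Riordan-column₀ : ∀ g h i → Riordan g h i zero ≈ g i
  Riordan-column₀ g h = ⋆-identityʳ g

  Riordan-column-suc : ∀ g h k → (λ i → Riordan g h i (suc k)) ≋ ((λ i → Riordan g h i k) ⋆ h)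
  Riordan-column-suc g h k i =
    trans (⋆-congˡ g (λ n → sym (pow-comm h k n)) i) (sym (⋆-assoc g (pow h k) h i))

  lower : ∀ {k} → (Fin k → ℕ) → Fin k → ℕ
  lower R = pred ∘ R

  zero-or-pos : ∀ n → n ≡ 0 ⊎ 0 ℕ.< n
  zero-or-pos zero    = inj₁ ≡.refl
  zero-or-pos (suc n) = inj₂ (s≤s z≤n)

  shift-increasing : ∀ {k} {T : Fin k → ℕ} → Increasing T → Increasing (shift T)
  shift-increasing inc a b a<b = s≤s (inc a b a<b)

  0∷-increasing : ∀ {k} {R : Fin k → ℕ} → Increasing R → (∀ a → 0 ℕ.< R a) → Increasing (0 ∷ R)
  0∷-increasing inc 0<R zero    (suc b) _         = 0<R b
  0∷-increasing inc 0<R (suc a) (suc b) (s≤s a<b) = inc a b a<b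

  0∷shift-increasing : ∀ {k} {T : Fin k → ℕ} → Increasing T → Increasing (0 ∷ shift T)
  0∷shift-increasing inc = 0∷-increasing (shift-increasing inc) (λ _ → s≤s z≤n)

  tail-increasing : ∀ {k} {R : Fin (suc k) → ℕ} → Increasing R → Increasing (R ∘ suc)
  tail-increasing inc a b a<b = inc (suc a) (suc b) (s≤s a<b)

  increasing-tail-pos : ∀ {k} {R : Fin (suc k) → ℕ} → Increasing R → ∀ a → 0 ℕ.< R (suc a)
  increasing-tail-pos inc a = ℕₚ.≤-<-trans z≤n (inc zero (suc a) (s≤s z≤n))

  increasing-pos : ∀ {k} {R : Fin (suc k) → ℕ} → Increasing R → 0 ℕ.< R zero → ∀ a → 0 ℕ.< R a
  increasing-pos inc 0<R₀ zero    = 0<R₀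
  increasing-pos inc 0<R₀ (suc a) = increasing-tail-pos inc a

  lower-increasing : ∀ {k} {R : Fin (suc k) → ℕ} → Increasing R → 0 ℕ.< R zero → Increasing (lower R)
  lower-increasing inc 0<R₀ a b a<b =
    ℕₚ.pred-mono-< {{ℕ.>-nonZero (increasing-pos inc 0<R₀ a)}} (inc a b a<b)

  lowerTail-increasing : ∀ {k} {R : Fin (suc k) → ℕ} → Increasing R → Increasing (lower (R ∘ suc))
  lowerTail-increasing inc a b a<b =
    ℕₚ.pred-mono-< {{ℕ.>-nonZero (increasing-tail-pos inc a)}} (tail-increasing inc a b a<b)

  shift-lower : ∀ {k} {R : Fin k → ℕ} → (∀ a → 0 ℕ.< R a) → shift (lower R) ≗ R
  shift-lower 0<R a = ℕₚ.suc-pred _ {{ℕ.>-nonZero (0<R a)}}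

  lower-< : ∀ {x m} → 0 ℕ.< x → x ℕ.< suc m → pred x ℕ.< m
  lower-< (s≤s z≤n) (s≤s x<m) = x<m

  bound : ∀ {k} → (Fin k → ℕ) → ℕ
  bound {zero}  R = 0
  bound {suc k} R = R zero ℕ.+ bound (R ∘ suc)

  ≤-bound : ∀ {k} (R : Fin k → ℕ) a → R a ℕ.≤ bound R
  ≤-bound R zero    = ℕₚ.m≤m+n (R zero) _
  ≤-bound R (suc a) = ℕₚ.≤-trans (≤-bound (R ∘ suc) a) (ℕₚ.m≤n+m _ (R zero))

  sumSubsets-nonneg : ∀ m k {G : RowFunction k} → (∀ S → Increasing S → 0# ≤ G S) → 0# ≤ sumSubsets m k G
  sumSubsets-nonneg m       zero    0≤G = 0≤G [] (λ ())
  sumSubsets-nonneg zero    (suc k) 0≤G = 0≤0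
  sumSubsets-nonneg (suc m) (suc k) 0≤G =
    +-nonneg (sumSubsets-nonneg m k (λ T inc → 0≤G (0 ∷ shift T) (0∷shift-increasing inc)))
             (sumSubsets-nonneg m (suc k) (λ T inc → 0≤G (shift T) (shift-increasing inc)))

  sumSubsets-pos : ∀ m k {G : RowFunction k} → Extensional G → (∀ S → Increasing S → 0# ≤ G S) →
    ∀ S → Increasing S → (∀ a → S a ℕ.< m) → 0# < G S → 0# < sumSubsets m k G
  sumSubsets-pos m       zero    ext 0≤G S inc S<m 0<GS = <-respʳ-≈ (ext (λ ())) 0<GS
  sumSubsets-pos zero    (suc k) ext 0≤G S inc S<m 0<GS with S<m zero
  ... | ()
  sumSubsets-pos (suc m) (suc k) ext 0≤G S inc S<m 0<GS with zero-or-pos (S zero)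
  ... | inj₁ S₀≡0 = +-pos-nonneg
    (sumSubsets-pos m k (Extensional-shift (Extensional-∷ 0 ext))
      (λ T inc′ → 0≤G (0 ∷ shift T) (0∷shift-increasing inc′))
      (lower (S ∘ suc)) (lowerTail-increasing inc) (λ a → lower-< (increasing-tail-pos inc a) (S<m (suc a)))
      (<-respʳ-≈ (ext λ { zero → S₀≡0 ; (suc a) → ≡.sym (shift-lower (increasing-tail-pos inc) a) }) 0<GS))
    (sumSubsets-nonneg m (suc k) (λ T inc′ → 0≤G (shift T) (shift-increasing inc′)))
  ... | inj₂ 0<S₀ = +-nonneg-pos
    (sumSubsets-nonneg m k (λ T inc′ → 0≤G (0 ∷ shift T) (0∷shift-increasing inc′)))
    (sumSubsets-pos m (suc k) (Extensional-shift ext)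
      (λ T inc′ → 0≤G (shift T) (shift-increasing inc′))
      (lower S) (lower-increasing inc 0<S₀) (λ a → lower-< (increasing-pos inc 0<S₀ a) (S<m a))
      (<-respʳ-≈ (ext (≡.sym ∘ shift-lower (increasing-pos inc 0<S₀))) 0<GS))

  -- The factorisation R(g, h) = L(g, h) · (1 ⊕ R(g, h))

  LeftProd-suc-≤ : ∀ g h {i j} → j ℕ.≤ i → LeftProd g h i (suc j) ≈ h (i ∸ j)
  LeftProd-suc-≤ g h {i} {j} j≤i with j ≤ᵇ i | ℕₚ.≤⇒≤ᵇ j≤i
  ... | true | _ = refl

  LeftProd-suc-> : ∀ g h {i j} → i ℕ.< j → LeftProd g h i (suc j) ≈ 0#
  LeftProd-suc-> g h {i} {j} i<j with j ≤ᵇ i | ℕₚ.≤ᵇ⇒≤ j i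
  ... | false | _    = refl
  ... | true  | j≤i = ⊥-elim (ℕₚ.<⇒≱ i<j (j≤i _))

  ⋆-as-LeftProd-row : ∀ g h (c : Series) i N → i ℕ.< N →
    sumF N (λ j → LeftProd g h i (suc (toℕ j)) * c (toℕ j)) ≈ (c ⋆ h) i
  ⋆-as-LeftProd-row g h c i N i<N = begin
    sumF N (φ ∘ toℕ)                        ≡⟨ ≡.cong (λ n → sumF n (φ ∘ toℕ)) (ℕₚ.m+[n∸m]≡n i<N) ⟨
    sumF (suc i ℕ.+ (N ∸ suc i)) (φ ∘ toℕ)  ≈⟨ sumF-split (suc i) (N ∸ suc i) φ ⟩
    sumF (suc i) (φ ∘ toℕ) + sumF (N ∸ suc i) (λ j → φ (suc i ℕ.+ toℕ j))
      ≈⟨ +-cong (sumF-cong (suc i) λ j → trans (*-congʳ (LeftProd-suc-≤ g h (Finₚ.toℕ≤pred[n] j)))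
                                                (*-comm _ (c (toℕ j))))
                (sumF-≈0 (N ∸ suc i) λ j → trans (*-congʳ (LeftProd-suc-> g h (ℕₚ.m≤m+n (suc i) (toℕ j))))
                                                  (zeroˡ (c (suc i ℕ.+ toℕ j)))) ⟩
    (c ⋆ h) i + 0#                                         ≈⟨ +-identityʳ _ ⟩
    (c ⋆ h) i ∎
    where
    φ : ℕ → Carrier
    φ j = LeftProd g h i (suc j) * c j

  bordered : Matrix → Matrix
  bordered A zero    zero    = 1#
  bordered A zero    (suc b) = 0#
  bordered A (suc a) zero    = 0#
  bordered A (suc a) (suc b) = A a b

  Riordan-factorisation : ∀ g h i b N → i ℕ.< N →
    sumF (suc N) (λ j → LeftProd g h i (toℕ j) * bordered (Riordan g h) (toℕ j) b) ≈ Riordan g h i b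
  Riordan-factorisation g h i zero    N i<N = begin
    g i * 1# + sumF N (λ j → LeftProd g h i (suc (toℕ j)) * 0#)
      ≈⟨ +-cong (*-identityʳ (g i)) (sumF-≈0 N (λ j → zeroʳ _)) ⟩
    g i + 0#  ≈⟨ +-identityʳ _ ⟩
    g i       ≈⟨ sym (Riordan-column₀ g h i) ⟩
    Riordan g h i zero ∎
  Riordan-factorisation g h i (suc b) N i<N = begin
    g i * 0# + sumF N (λ j → LeftProd g h i (suc (toℕ j)) * Riordan g h (toℕ j) b)
      ≈⟨ trans (+-congʳ (zeroʳ (g i))) (+-identityˡ _) ⟩
    sumF N (λ j → LeftProd g h i (suc (toℕ j)) * Riordan g h (toℕ j) b)
      ≈⟨ ⋆-as-LeftProd-row g h (λ j → Riordan g h j b) i N i<N ⟩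
    ((λ j → Riordan g h j b) ⋆ h) i
      ≈⟨ sym (Riordan-column-suc g h b i) ⟩
    Riordan g h i (suc b) ∎

  Riordan-minor-factorisation : ∀ g h k (r s : Fin k → ℕ) →
    minor (Riordan g h) k r s ≈
    sumSubsets (suc (suc (bound r))) k (λ S → minor (LeftProd g h) k r S * minor (bordered (Riordan g h)) k S s)
  Riordan-minor-factorisation g h k r s = trans
    (det-cong k λ a b → sym (Riordan-factorisation g h (r a) (s b) (suc (bound r)) (s≤s (≤-bound r a))))
    (cauchy-binet k (suc (suc (bound r))) (LeftProd g h ∘ r) (λ j b → bordered (Riordan g h) j (s b)))

  bordered-row₀ : ∀ A {y} → 0 ℕ.< y → bordered A 0 y ≈ 0#
  bordered-row₀ A (s≤s _) = refl

  bordered-column₀ : ∀ A {x} → 0 ℕ.< x → bordered A x 0 ≈ 0#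
  bordered-column₀ A (s≤s _) = refl

  bordered-lower : ∀ A {x y} → 0 ℕ.< x → 0 ℕ.< y → bordered A x y ≈ A (pred x) (pred y)
  bordered-lower A (s≤s _) (s≤s _) = refl

  bordered-minor-corner : ∀ A k {S s : Fin (suc k) → ℕ} → Increasing S → Increasing s → S zero ≡ 0 → s zero ≡ 0 →
    minor (bordered A) (suc k) S s ≈ minor A k (lower (S ∘ suc)) (lower (s ∘ suc))
  bordered-minor-corner A k {S} {s} incS incs S₀≡0 s₀≡0 = begin
    1# * (bordered A (S zero) (s zero) * minor (bordered A) k (S ∘ suc) (s ∘ suc)) + others
      ≈⟨ +-cong (trans (*-identityˡ _) (*-cong (reflexive (≡.cong₂ (bordered A) S₀≡0 s₀≡0)) lowered)) others≈0 ⟩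
    1# * minor A k (lower (S ∘ suc)) (lower (s ∘ suc)) + 0#
      ≈⟨ trans (+-identityʳ _) (*-identityˡ _) ⟩
    minor A k (lower (S ∘ suc)) (lower (s ∘ suc)) ∎
    where
    others : Carrier
    others = sumF k (λ j → sgn (suc j) * (bordered A (S zero) (s (suc j)) *
                            det k (λ a b → bordered A (S (suc a)) (s (punchIn (suc j) b)))))
    row₀ : ∀ j → bordered A (S zero) (s (suc j)) ≈ 0#
    row₀ j = trans (reflexive (≡.cong (λ x → bordered A x (s (suc j))) S₀≡0)) (bordered-row₀ A (increasing-tail-pos incs j))
    others≈0 : others ≈ 0#
    others≈0 = sumF-≈0 k λ j → trans (*-congˡ (trans (*-congʳ (row₀ j)) (zeroˡ _))) (zeroʳ (sgn (suc j)))
    lowered : minor (bordered A) k (S ∘ suc) (s ∘ suc) ≈ minor A k (lower (S ∘ suc)) (lower (s ∘ suc))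
    lowered = det-cong k λ a b → bordered-lower A (increasing-tail-pos incS a) (increasing-tail-pos incs b)

  bordered-minor-lower : ∀ A k {S s : Fin (suc k) → ℕ} → Increasing S → Increasing s → 0 ℕ.< S zero → 0 ℕ.< s zero →
    minor (bordered A) (suc k) S s ≈ minor A (suc k) (lower S) (lower s)
  bordered-minor-lower A k incS incs 0<S₀ 0<s₀ =
    det-cong (suc k) λ a b → bordered-lower A (increasing-pos incS 0<S₀ a) (increasing-pos incs 0<s₀ b)

  bordered-minor-row₀ : ∀ A k {S s : Fin (suc k) → ℕ} → Increasing s → S zero ≡ 0 → 0 ℕ.< s zero →
    minor (bordered A) (suc k) S s ≈ 0#
  bordered-minor-row₀ A k {S} {s} incs S₀≡0 0<s₀ = det-zero-row₀ k (λ a b → bordered A (S a) (s b)) λ b →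
    trans (reflexive (≡.cong (λ x → bordered A x (s b)) S₀≡0)) (bordered-row₀ A (increasing-pos incs 0<s₀ b))

  bordered-minor-column₀ : ∀ A k {S s : Fin (suc k) → ℕ} → Increasing S → 0 ℕ.< S zero → s zero ≡ 0 →
    minor (bordered A) (suc k) S s ≈ 0#
  bordered-minor-column₀ A k {S} {s} incS 0<S₀ s₀≡0 = det-zero-column₀ k (λ a b → bordered A (S a) (s b)) λ a →
    trans (reflexive (≡.cong (bordered A (S a)) s₀≡0)) (bordered-column₀ A (increasing-pos incS 0<S₀ a))

  -- Total positivity by induction on the largest column index

  TP-below : ℕ → Matrix → Set (ℓ₁ ⊔ ℓ₂)
  TP-below K A = ∀ k (r s : Fin k → ℕ) → Increasing r → Increasing s → (∀ b → s b ℕ.< K) → 0# ≤ minor A k r s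

  TP-below-0 : ∀ A → TP-below 0 A
  TP-below-0 A zero    r s incr incs s<0 = inj₁ 0<1
  TP-below-0 A (suc k) r s incr incs s<0 with s<0 zero
  ... | ()

  bordered-TP-below : ∀ {A} K → TP-below K A → TP-below (suc K) (bordered A)
  bordered-TP-below K tp zero    r s incr incs s<K = inj₁ 0<1
  bordered-TP-below {A} K tp (suc k) r s incr incs s<K with zero-or-pos (r zero) | zero-or-pos (s zero)
  ... | inj₁ r₀≡0 | inj₁ s₀≡0 = 0≤-resp-≈ (sym (bordered-minor-corner A k {r} {s} incr incs r₀≡0 s₀≡0))
    (tp k _ _ (lowerTail-increasing incr) (lowerTail-increasing incs)
       (λ b → lower-< (increasing-tail-pos incs b) (s<K (suc b))))
  ... | inj₁ r₀≡0 | inj₂ 0<s₀ = inj₂ (sym (bordered-minor-row₀ A k {r} {s} incs r₀≡0 0<s₀))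
  ... | inj₂ 0<r₀ | inj₁ s₀≡0 = inj₂ (sym (bordered-minor-column₀ A k {r} {s} incr 0<r₀ s₀≡0))
  ... | inj₂ 0<r₀ | inj₂ 0<s₀ = 0≤-resp-≈ (sym (bordered-minor-lower A k {r} {s} incr incs 0<r₀ 0<s₀))
    (tp (suc k) _ _ (lower-increasing incr 0<r₀) (lower-increasing incs 0<s₀)
       (λ b → lower-< (increasing-pos incs 0<s₀ b) (s<K b)))

  Riordan-TP-below : ∀ g h K → TP (LeftProd g h) → TP-below K (bordered (Riordan g h)) → TP-below K (Riordan g h)
  Riordan-TP-below g h K tpL tpB k r s incr incs s<K =
    0≤-resp-≈ (sym (Riordan-minor-factorisation g h k r s))
      (sumSubsets-nonneg _ k λ S incS → *-nonneg (tpL k r S incr incS) (tpB k S s incS incs s<K))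

  Riordan-TP : ∀ g h → TP (LeftProd g h) → TP (Riordan g h)
  Riordan-TP g h tpL k r s incr incs = below (suc (bound s)) k r s incr incs (λ b → s≤s (≤-bound s b))
    where
    below : ∀ K → TP-below K (Riordan g h)
    below zero    = TP-below-0 (Riordan g h)
    below (suc K) = Riordan-TP-below g h (suc K) tpL (bordered-TP-below K (below K))

  MinorClass : Set₁
  MinorClass = (k : ℕ) → (Fin k → ℕ) → (Fin k → ℕ) → Set

  Pos-below : MinorClass → ℕ → Matrix → Set ℓ₂
  Pos-below Q K A = ∀ k (r s : Fin k → ℕ) → Increasing r → Increasing s → (∀ b → s b ℕ.< K) → Q k r s →
    0# < minor A k r s

  -- How a minor of 1 ⊕ A with rows S and columns s reduces to a Q-minor of A.
  data Descends (Q : MinorClass) {k} (S s : Fin (suc k) → ℕ) : Set where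
    corner   : S zero ≡ 0 → s zero ≡ 0 → Q k (lower (S ∘ suc)) (lower (s ∘ suc)) → Descends Q S s
    interior : 0 ℕ.< S zero → 0 ℕ.< s zero → Q (suc k) (lower S) (lower s) → Descends Q S s

  bordered-minor-pos : ∀ {Q A} K → Pos-below Q K A → ∀ {k} {S s : Fin (suc k) → ℕ} → Increasing S → Increasing s →
    (∀ b → s b ℕ.< suc K) → Descends Q S s → 0# < minor (bordered A) (suc k) S s
  bordered-minor-pos {A = A} K pos {k} {S} {s} incS incs s<K (corner S₀≡0 s₀≡0 q) =
    <-respʳ-≈ (sym (bordered-minor-corner A k {S} {s} incS incs S₀≡0 s₀≡0))
      (pos k _ _ (lowerTail-increasing incS) (lowerTail-increasing incs)
         (λ b → lower-< (increasing-tail-pos incs b) (s<K (suc b))) q)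
  bordered-minor-pos {A = A} K pos {k} {S} {s} incS incs s<K (interior 0<S₀ 0<s₀ q) =
    <-respʳ-≈ (sym (bordered-minor-lower A k {S} {s} incS incs 0<S₀ 0<s₀))
      (pos (suc k) _ _ (lower-increasing incS 0<S₀) (lower-increasing incs 0<s₀)
         (λ b → lower-< (increasing-pos incs 0<s₀ b) (s<K b)) q)

  -- A column set S with a positive minor of L, through which a Q-minor of R = L · (1 ⊕ R) descends.
  record Witness (L : Matrix) (Q : MinorClass) {k} (r s : Fin (suc k) → ℕ) : Set ℓ₂ where
    field
      columns    : Fin (suc k) → ℕ
      increasing : Increasing columns
      bounded    : ∀ a → columns a ℕ.≤ suc (r a)
      minor-pos  : 0# < minor L (suc k) r columns
      descends   : Descends Q columns s

  Witnessed : Matrix → MinorClass → Set ℓ₂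
  Witnessed L Q = ∀ k (r s : Fin (suc k) → ℕ) → Increasing r → Increasing s → Q (suc k) r s → Witness L Q r s

  Riordan-Pos-below : ∀ g h (Q : MinorClass) K → TP (LeftProd g h) →
    Witnessed (LeftProd g h) Q →
    Pos-below Q K (Riordan g h) → Pos-below Q (suc K) (Riordan g h)
  Riordan-Pos-below g h Q K tpL witness pos zero    r s incr incs s<K q = 0<1
  Riordan-Pos-below g h Q K tpL witness pos (suc k) r s incr incs s<K q =
    <-respʳ-≈ (sym (Riordan-minor-factorisation g h (suc k) r s))
      (sumSubsets-pos _ (suc k) extensional nonneg columns increasing
        (λ a → s≤s (ℕₚ.≤-trans (bounded a) (s≤s (≤-bound r a))))
        (*-pos minor-pos (bordered-minor-pos K pos increasing incs s<K descends)))
    where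
    open Witness (witness k r s incr incs q)
    term : RowFunction (suc k)
    term S = minor (LeftProd g h) (suc k) r S * minor (bordered (Riordan g h)) (suc k) S s
    extensional : Extensional term
    extensional S≗S′ = *-cong (det-cong (suc k) λ a b → reflexive (≡.cong (LeftProd g h (r a)) (S≗S′ b)))
                              (det-cong (suc k) λ a b → reflexive (≡.cong (λ x → bordered (Riordan g h) x (s b)) (S≗S′ a)))
    nonneg : ∀ S → Increasing S → 0# ≤ term S
    nonneg S incS = *-nonneg (tpL (suc k) r S incr incS)
      (bordered-TP-below K (λ k r s incr incs _ → Riordan-TP g h tpL k r s incr incs) (suc k) S s incS incs s<K)

  Riordan-pos : ∀ g h (Q : MinorClass) → TP (LeftProd g h) →
    Witnessed (LeftProd g h) Q →
    ∀ k (r s : Fin k → ℕ) → Increasing r → Increasing s → Q k r s → 0# < minor (Riordan g h) k r s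
  Riordan-pos g h Q tpL witness k r s incr incs = below (suc (bound s)) k r s incr incs (λ b → s≤s (≤-bound s b))
    where
    below : ∀ K → Pos-below Q K (Riordan g h)
    below zero    zero    r s incr incs s<0 q = 0<1
    below zero    (suc k) r s incr incs s<0 q with s<0 zero
    ... | ()
    below (suc K) = Riordan-Pos-below g h Q K tpL witness (below K)

  allMinors : MinorClass
  allMinors _ _ _ = ⊤

  lowerMinors : MinorClass
  lowerMinors k r s = ∀ l → s l ℕ.≤ r l

  LeftProd-diagonal : ∀ g h i → LeftProd g h i (suc i) ≈ h 0
  LeftProd-diagonal g h i = trans (LeftProd-suc-≤ g h (ℕₚ.≤-refl {i})) (reflexive (≡.cong h (ℕₚ.n∸n≡0 i)))

  LeftProd-witness : ∀ g f → (∀ n → 0# < f n) → (∀ n → 0# < g n) →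
    Witnessed (LeftProd g f) allMinors
  LeftProd-witness g f 0<f 0<g k r s incr incs _ with zero-or-pos (s zero)
  ... | inj₁ s₀≡0 = record
    { columns    = columns
    ; increasing = 0∷shift-increasing (tail-increasing incr)
    ; bounded    = λ { zero → z≤n ; (suc a) → ℕₚ.≤-refl }
    ; minor-pos  = det-lowerTriangular-pos (suc k) (λ a b → LeftProd g f (r a) (columns b))
        (λ { zero (suc b) _ → above zero (suc b) (s≤s z≤n) ; (suc a) (suc b) a<b → above (suc a) (suc b) a<b })
        (λ { zero → 0<g (r zero) ; (suc a) → diagonal (suc a) })
    ; descends   = corner ≡.refl s₀≡0 tt
    }
    where
    columns : Fin (suc k) → ℕ
    columns = 0 ∷ shift (r ∘ suc)
    above : ∀ a b → a Fin.< b → LeftProd g f (r a) (suc (r b)) ≈ 0#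
    above a b a<b = LeftProd-suc-> g f (incr a b a<b)
    diagonal : ∀ a → 0# < LeftProd g f (r a) (suc (r a))
    diagonal a = <-respʳ-≈ (sym (LeftProd-diagonal g f (r a))) (0<f 0)
  ... | inj₂ 0<s₀ = record
    { columns    = shift r
    ; increasing = shift-increasing incr
    ; bounded    = λ _ → ℕₚ.≤-refl
    ; minor-pos  = det-lowerTriangular-pos (suc k) (λ a b → LeftProd g f (r a) (shift r b))
        (λ a b a<b → LeftProd-suc-> g f (incr a b a<b))
        (λ a → <-respʳ-≈ (sym (LeftProd-diagonal g f (r a))) (0<f 0))
    ; descends   = interior (s≤s z≤n) 0<s₀ tt
    }

  LeftProd-xTimes-above : ∀ g f {i x} → i ℕ.< x → LeftProd g (xTimes f) i x ≈ 0#
  LeftProd-xTimes-above g f {i} {suc j} (s≤s i≤j) with j ≤ᵇ i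
  ... | false = refl
  ... | true  = reflexive (≡.cong (xTimes f) (ℕₚ.m≤n⇒m∸n≡0 i≤j))

  LeftProd-xTimes-diagonal : ∀ g f {x} → 0 ℕ.< x → LeftProd g (xTimes f) x x ≈ f 0
  LeftProd-xTimes-diagonal g f {suc j} _ =
    trans (LeftProd-suc-≤ g (xTimes f) (ℕₚ.n≤1+n j)) (reflexive (≡.cong (xTimes f) (ℕₚ.m+n∸n≡m 1 j)))

  LeftProd-xTimes-witness : ∀ g f → (∀ n → 0# < f n) → (∀ n → 0# < g n) →
    Witnessed (LeftProd g (xTimes f)) lowerMinors
  LeftProd-xTimes-witness g f 0<f 0<g k r s incr incs s≤r with zero-or-pos (s zero)
  ... | inj₁ s₀≡0 = record
    { columns    = columns
    ; increasing = 0∷-increasing (tail-increasing incr) (increasing-tail-pos incr)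
    ; bounded    = λ { zero → z≤n ; (suc a) → ℕₚ.n≤1+n _ }
    ; minor-pos  = det-lowerTriangular-pos (suc k) (λ a b → LeftProd g (xTimes f) (r a) (columns b))
        (λ { zero (suc b) _ → above zero (suc b) (s≤s z≤n) ; (suc a) (suc b) a<b → above (suc a) (suc b) a<b })
        (λ { zero → 0<g (r zero) ; (suc a) → diagonal (suc a) (increasing-tail-pos incr a) })
    ; descends   = corner ≡.refl s₀≡0 (λ l → ℕₚ.pred-mono-≤ (s≤r (suc l)))
    }
    where
    columns : Fin (suc k) → ℕ
    columns = 0 ∷ (r ∘ suc)
    above : ∀ a b → a Fin.< b → LeftProd g (xTimes f) (r a) (r b) ≈ 0#
    above a b a<b = LeftProd-xTimes-above g f (incr a b a<b)
    diagonal : ∀ a → 0 ℕ.< r a → 0# < LeftProd g (xTimes f) (r a) (r a)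
    diagonal a 0<rₐ = <-respʳ-≈ (sym (LeftProd-xTimes-diagonal g f 0<rₐ)) (0<f 0)
  ... | inj₂ 0<s₀ = record
    { columns    = r
    ; increasing = incr
    ; bounded    = λ _ → ℕₚ.n≤1+n _
    ; minor-pos  = det-lowerTriangular-pos (suc k) (λ a b → LeftProd g (xTimes f) (r a) (r b))
        (λ a b a<b → LeftProd-xTimes-above g f (incr a b a<b))
        (λ a → <-respʳ-≈ (sym (LeftProd-xTimes-diagonal g f (increasing-pos incr 0<r₀ a))) (0<f 0))
    ; descends   = interior 0<r₀ 0<s₀ (λ l → ℕₚ.pred-mono-≤ (s≤r l))
    }
    where
    0<r₀ : 0 ℕ.< r zero
    0<r₀ = ℕₚ.<-≤-trans 0<s₀ (s≤r zero)

mainTheorem5 : ∀ {c ℓ₁ ℓ₂} (F : OrderedField c ℓ₁ ℓ₂) →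
    let open OrderedField F in
    let open Theory F in
    (g f : ℕ → Carrier) → (∀ n → 0# < f n) → (∀ n → 0# < g n) →
    (TP (LeftProd g f) → STP (Riordan g f)) ×
    (TP (LeftProd g (xTimes f)) → LSTP (Riordan g (xTimes f)))
mainTheorem5 F g f 0<f 0<g =
  (λ tpL k r s incr incs → Riordan-pos g f allMinors tpL (LeftProd-witness g f 0<f 0<g) k r s incr incs tt) ,
  (λ tpL → Riordan-TP g (xTimes f) tpL , Riordan-pos g (xTimes f) lowerMinors tpL (LeftProd-xTimes-witness g f 0<f 0<g))
  where
  open Theory F using (xTimes)
  open RiordanTotalPositivity F
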